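{- Let $F$ be any field and $n,m\ge1$. If $f:F^n\to F^n$ and $g:F^m\to F^m$ are permutations each having $1$-affinity $0$, then the permutation $f\times g: F^n\times F^m\to F^n\times F^m$, $(x,y)\mapsto (f(x),g(y))$, has $1$-affinity $0$.
   Context: A line ($1$-flat) in $F^n$ is a coset of a $1$-dimensional subspace. A permutation has $1$-affinity $0$ if no line is mapped onto a line. -}

module Defs where

open import Level using (Level; _⊔_; suc)
open import Data.Nat as ℕ using (ℕ)
open import Data.Fin using (Fin)
open import Data.Product using (Σ; ∃; _×_)
open import Relation.Nullary using (¬_)
open import Algebra.Bundles using (CommutativeRing)
import Data.Vec.Functional as VF

record Field (c ℓ : Level) : Set (suc (c ⊔ ℓ)) where
  field
    commRing : CommutativeRing c ℓ
  open CommutativeRing commRing public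
  field
    0≉1     : ¬ (0# ≈ 1#)
    inverse : ∀ x → ¬ (x ≈ 0#) → Σ Carrier λ y → x * y ≈ 1#

module FieldSpace {c ℓ : Level} (F : Field c ℓ) where
  open Field F

  Pt : ℕ → Set c
  Pt n = Fin n → Carrier

  _≋_ : ∀ {n} → Pt n → Pt n → Set ℓ
  x ≋ y = ∀ i → x i ≈ y i

  zeroPt : ∀ {n} → Pt n
  zeroPt _ = 0#

  _+ₚ_·_ : ∀ {n} → Pt n → Carrier → Pt n → Pt n
  (a +ₚ t · v) i = a i + t * v i

  record Line (n : ℕ) : Set (c ⊔ ℓ) where
    constructor line
    field
      base    : Pt n
      dir     : Pt n
      dir≠0   : ¬ (dir ≋ zeroPt)

  _∈L_ : ∀ {n} → Pt n → Line n → Set (c ⊔ ℓ)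
  x ∈L L = Σ Carrier λ t → x ≋ (Line.base L +ₚ t · Line.dir L)

  MapsOnto : ∀ {n} → (Pt n → Pt n) → Line n → Line n → Set (c ⊔ ℓ)
  MapsOnto f L L' =
    (∀ x → x ∈L L → f x ∈L L') ×
    (∀ y → y ∈L L' → Σ (Pt _) λ x → x ∈L L × (f x ≋ y))

  record IsPermutation {n : ℕ} (f : Pt n → Pt n) : Set (c ⊔ ℓ) where
    field
      cong₁ : ∀ {x y} → x ≋ y → f x ≋ f y
      inj   : ∀ {x y} → f x ≋ f y → x ≋ y
      surj  : ∀ y → Σ (Pt n) λ x → f x ≋ y

  Affinity0 : ∀ {n} → (Pt n → Pt n) → Set (c ⊔ ℓ)
  Affinity0 f = ∀ L L' → ¬ MapsOnto f L L'

  -- f × g on F^n × F^m ≅ F^(n+m), (x , y) ↦ (f x , g y)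
  _×ₚ_ : ∀ {n m} → (Pt n → Pt n) → (Pt m → Pt m) → Pt (n ℕ.+ m) → Pt (n ℕ.+ m)
  _×ₚ_ {n} {m} f g z = f (VF.take n z) VF.++ g (VF.drop n z)

module Submission where

open import Defs
open import Level using (Level; _⊔_)
open import Data.Nat as ℕ using (ℕ; _≥_)
open import Data.Fin using (Fin; _↑ˡ_; _↑ʳ_; splitAt)
open import Data.Fin.Properties using (splitAt-↑ˡ; splitAt-↑ʳ; join-splitAt)
open import Data.Product using (Σ; _×_; _,_; proj₁; proj₂)
open import Data.Sum using (inj₁; inj₂)
open import Function using (_∘_)
open import Relation.Nullary using (¬_; yes; no)
open import Relation.Nullary.Decidable using (¬¬-excluded-middle)
import Relation.Binary.PropositionalEquality as ≡
import Algebra.Properties.Group as GroupProperties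

-- If f × g mapped a line L onto a line L', then on each block of coordinates
-- where the direction of L does not vanish, the factor acting there would map
-- the projection of L onto the projection of L' (or, if that projection were a
-- single point, injectivity would force the direction to vanish after all).
-- Affinity 0 of both factors thus makes the direction of L vanish on both
-- blocks, i.e. everywhere.

module _ {c ℓ : Level} (F : Field c ℓ) where
  open Field F
  open FieldSpace F
  open GroupProperties +-group using () renaming (∙-cancelˡ to +-cancelˡ)
  open import Relation.Binary.Reasoning.Setoid setoid

  x≈0⇒a+s*x≈a : ∀ a s {x} → x ≈ 0# → a + s * x ≈ a
  x≈0⇒a+s*x≈a a s x≈0 = trans (+-congˡ (trans (*-congˡ x≈0) (zeroʳ s))) (+-identityʳ a)

  a+0*x≈a+1*x⇒x≈0 : ∀ a x → a + 0# * x ≈ a + 1# * x → x ≈ 0#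
  a+0*x≈a+1*x⇒x≈0 a x eq = begin
    x       ≈⟨ *-identityˡ x ⟨
    1# * x  ≈⟨ +-cancelˡ a _ _ eq ⟨
    0# * x  ≈⟨ zeroˡ x ⟩
    0#      ∎

  point-∈L : ∀ {n} (L : Line n) t → (Line.base L +ₚ t · Line.dir L) ∈L L
  point-∈L L t = t , λ _ → refl

  module Restriction {N k : ℕ} (ι : Fin k → Fin N) where

    Restricts : (Pt N → Pt N) → (Pt k → Pt k) → Set (c ⊔ ℓ)
    Restricts Φ f = ∀ z → (Φ z ∘ ι) ≋ f (z ∘ ι)

    restrictLine : (L : Line N) → ¬ ((Line.dir L ∘ ι) ≋ zeroPt) → Line k
    restrictLine (line a d _) = line (a ∘ ι) (d ∘ ι)

    ∈L-restrict : ∀ {x} L nz → x ∈L L → (x ∘ ι) ∈L restrictLine L nz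
    ∈L-restrict _ _ (t , x≋) = t , λ i → x≋ (ι i)

    module _ (Φ : Pt N → Pt N) (f : Pt k → Pt k) (res : Restricts Φ f)
             (L L' : Line N) (onto : MapsOnto Φ L L') where
      open Line L renaming (base to a; dir to d)
      open Line L' renaming (base to a'; dir to d')

      image-constant : (d' ∘ ι) ≋ zeroPt → ∀ z → z ∈L L → f (z ∘ ι) ≋ (a' ∘ ι)
      image-constant d'≋0 z z∈L i with proj₁ onto z z∈L
      ... | s , Φz≋ = trans (sym (res z i)) (trans (Φz≋ (ι i)) (x≈0⇒a+s*x≈a _ s (d'≋0 i)))

      image-dir-vanishes⇒dir-vanishes : (∀ {x y} → f x ≋ f y → x ≋ y) →
        (d' ∘ ι) ≋ zeroPt → (d ∘ ι) ≋ zeroPt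
      image-dir-vanishes⇒dir-vanishes inj d'≋0 i =
        a+0*x≈a+1*x⇒x≈0 (a (ι i)) (d (ι i)) (inj f₀≋f₁ i)
        where
        f₀≋f₁ : f ((a +ₚ 0# · d) ∘ ι) ≋ f ((a +ₚ 1# · d) ∘ ι)
        f₀≋f₁ j = trans (image-constant d'≋0 _ (point-∈L L 0#) j)
                        (sym (image-constant d'≋0 _ (point-∈L L 1#) j))

      restriction-maps-onto : (∀ {x y} → x ≋ y → f x ≋ f y) →
        (nz : ¬ ((d ∘ ι) ≋ zeroPt)) (nz' : ¬ ((d' ∘ ι) ≋ zeroPt)) →
        MapsOnto f (restrictLine L nz) (restrictLine L' nz')
      restriction-maps-onto f-cong nz nz' = forward , backward
        where
        forward : ∀ x → x ∈L restrictLine L nz → f x ∈L restrictLine L' nz'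
        forward x (t , x≋) with proj₁ onto _ (point-∈L L t)
        ... | s , Φz≋ = s , λ i → trans (f-cong x≋ i) (trans (sym (res _ i)) (Φz≋ (ι i)))

        backward : ∀ y → y ∈L restrictLine L' nz' →
                   Σ (Pt k) λ x → x ∈L restrictLine L nz × f x ≋ y
        backward y (s , y≋) with proj₂ onto _ (point-∈L L' s)
        ... | z , z∈L , Φz≋ = z ∘ ι , ∈L-restrict L nz z∈L ,
                              λ i → trans (sym (res z i)) (trans (Φz≋ (ι i)) (sym (y≋ i)))

      -- Vanishing is not decidable for an arbitrary field, so the case split
      -- happens under a double negation; the final goal ⊥ absorbs it.
      affinity0⇒dir-vanishes : IsPermutation f → Affinity0 f → ¬ ¬ ((d ∘ ι) ≋ zeroPt)
      affinity0⇒dir-vanishes perm aff nz = ¬¬-excluded-middle λ where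
          (yes d'≋0) → nz (image-dir-vanishes⇒dir-vanishes inj d'≋0)
          (no nz')   → aff (restrictLine L nz) (restrictLine L' nz')
                              (restriction-maps-onto cong₁ nz nz')
        where open IsPermutation perm

  module _ {n m : ℕ} (f : Pt n → Pt n) (g : Pt m → Pt m) where
    open Restriction

    ×ₚ-restricts-left : Restricts (_↑ˡ m) (f ×ₚ g) f
    ×ₚ-restricts-left z i rewrite splitAt-↑ˡ n i m = refl

    ×ₚ-restricts-right : Restricts (n ↑ʳ_) (f ×ₚ g) g
    ×ₚ-restricts-right z i rewrite splitAt-↑ʳ n m i = refl

  vanishes-on-both-blocks : ∀ {n m} {z : Pt (n ℕ.+ m)} →
    (z ∘ (_↑ˡ m)) ≋ zeroPt → (z ∘ (n ↑ʳ_)) ≋ zeroPt → z ≋ zeroPt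
  vanishes-on-both-blocks {n} {m} left right k with splitAt n k | join-splitAt n m k
  ... | inj₁ i | ≡.refl = left i
  ... | inj₂ i | ≡.refl = right i

lemma2p4 : ∀ {c ℓ : Level} (F : Field c ℓ) → let open FieldSpace F in
    (n m : ℕ) → n ≥ 1 → m ≥ 1 →
    (f : Pt n → Pt n) (g : Pt m → Pt m) →
    IsPermutation f → IsPermutation g →
    Affinity0 f → Affinity0 g →
    Affinity0 (f ×ₚ g)
lemma2p4 F n m _ _ f g f-perm g-perm f-aff g-aff L L' onto =
  affinity0⇒dir-vanishes (_↑ˡ m) (f ×ₚ g) f (×ₚ-restricts-left F f g) L L' onto
                         f-perm f-aff λ left →
  affinity0⇒dir-vanishes (n ↑ʳ_) (f ×ₚ g) g (×ₚ-restricts-right F f g) L L' onto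
                         g-perm g-aff λ right →
  Line.dir≠0 L (vanishes-on-both-blocks F left right)
  where open Restriction F
        open FieldSpace F using (_×ₚ_; module Line)
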